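{- Let $\lambda=(\lambda_1,\dots,\lambda_r)$ be a partition of $n$, let $N$ be a positive integer, and let $\mu\in\mathcal{R}_N(2n)$ satisfy $\mu_1>n$. Then $$\sum_{\tilde{\lambda}\in Ev(\lambda)} (-1)^{\ell(\tilde{\lambda})}\,\chi^{\mu}_{\tilde{\lambda}} = 0,$$ where the sum is over the multiset $Ev(\lambda)$, counted with multiplicity.
   Context: For a partition $\lambda=(\lambda_1,\dots,\lambda_r)$, $Ev(\lambda)$ is the multiset of $2^{r}$ partitions obtained as follows: for each of the $2^r$ choices, independently for each index $i=1,\dots,r$, replace the part $\lambda_i$ either by the single part $2\lambda_i$ or by the two parts $\lambda_i,\lambda_i$, and rewrite the result in decreasing order. Repeated parts in $\lambda$ are treated as different indices, so the same partition may occur several times in $Ev(\lambda)$. Each element of $Ev(\lambda)$ is a partition of $2n$. Here $\ell(\mu)$ is the number of parts of $\mu$. $\mathcal{R}_N(m)$ is the set of partitions $\mu$ of $m$ with $\ell(\mu)\le N$ all of whose parts $\mu_i$ are even. For partitions $\mu,\nu$ of $2n$, $\chi^{\mu}_{\nu}$ denotes the value of the irreducible character of the symmetric group $\Sigma_{2n}$ indexed by $\mu$ on the conjugacy class of cycle type $\nu$. Equivalently, $\chi^\mu_\nu=\langle p_\nu,s_\mu\rangle$, the Hall inner product of the power sum symmetric function $p_\nu$ and the Schur function $s_\mu$. -}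

module Defs where

open import Data.Nat using (ℕ; zero; suc; _+_; _*_; _∸_; _≤_; _<_; _≥_; _≤ᵇ_)
open import Data.Nat.Divisibility using (_∣_)
open import Data.Bool using (Bool; true; false; if_then_else_; _∧_)
open import Data.List using (List; []; _∷_; length; map; concatMap; filter; upTo; foldr)
open import Data.Bool.ListAction using (any; all)
open import Data.List.Relation.Unary.All using (All)
open import Data.Integer as ℤ using (ℤ; +_; -[1+_])
import Data.Integer.Properties as ℤP
open import Relation.Nullary.Decidable using (⌊_⌋)
open import Relation.Binary.PropositionalEquality using (_≡_)

data Decreasing : List ℕ → Set where
  dec-[]  : Decreasing []
  dec-one : ∀ {x} → Decreasing (x ∷ [])
  dec-∷   : ∀ {x y ys} → y ≤ x → Decreasing (y ∷ ys) → Decreasing (x ∷ y ∷ ys)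

sumℕ : List ℕ → ℕ
sumℕ = foldr _+_ 0

record IsPartitionOf (n : ℕ) (λ' : List ℕ) : Set where
  field
    decreasing : Decreasing λ'
    positive   : All (λ x → 1 ≤ x) λ'
    total      : sumℕ λ' ≡ n

firstPart : List ℕ → ℕ
firstPart []      = 0
firstPart (x ∷ _) = x

ℓ : List ℕ → ℕ
ℓ = length

InR : (N m : ℕ) → List ℕ → Set
InR N m μ = IsPartitionOf m μ × (ℓ μ ≤ N) × All (λ x → 2 ∣ x) μ
  where open import Data.Product using (_×_)

-- Ev(λ) as a list (multiset, multiplicities kept)

insert : ℕ → List ℕ → List ℕ
insert x []       = x ∷ []
insert x (y ∷ ys) = if y ≤ᵇ x then x ∷ y ∷ ys else y ∷ insert x ys

Ev : List ℕ → List (List ℕ)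
Ev []       = [] ∷ []
Ev (x ∷ xs) = concatMap (λ t → insert (2 * x) t ∷ insert x (insert x t) ∷ []) (Ev xs)

-- Irreducible characters of the symmetric group via the Frobenius
-- character formula:  χ^μ_ν = coefficient of x^(μ+δ) in a_δ(x)·p_ν(x),
-- in k = ℓ(μ) variables, δ = (k-1,…,1,0), a_δ = det(x_i^(δ_j)).
-- (Equivalently χ^μ_ν = ⟨p_ν , s_μ⟩.)

sumℤ : List ℤ → ℤ
sumℤ = foldr ℤ._+_ (+ 0)

negOnePow : ℕ → ℤ
negOnePow zero    = + 1
negOnePow (suc m) = ℤ.- negOnePow m

assignments : ℕ → ℕ → List (List ℕ)
assignments zero    k = [] ∷ []
assignments (suc r) k = concatMap (λ i → map (i ∷_) (assignments r k)) (upTo k)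

-- exponent vector μ + δ, padded to length k (entries μ_i + (k-1-i))
expVec : ℕ → List ℕ → List ℤ
expVec zero    μ        = []
expVec (suc k) []       = + k ∷ expVec k []
expVec (suc k) (m ∷ μ)  = + (m + k) ∷ expVec k μ

subAt : ℕ → ℤ → List ℤ → List ℤ
subAt i       d []       = []
subAt zero    d (x ∷ xs) = (x ℤ.- d) ∷ xs
subAt (suc i) d (x ∷ xs) = x ∷ subAt i d xs

residual : List ℤ → List ℕ → List ℕ → List ℤ
residual e (a ∷ ν) (i ∷ f) = subAt i (+ a) (residual e ν f)
residual e _       _       = e

-- does v (of length k) contain each of 0,…,k-1 (hence is a permutation of δ)?
isPermOfδ : ℕ → List ℤ → Bool
isPermOfδ k v = all (λ j → any (λ x → ⌊ x ℤ.≟ + j ⌋) v) (upTo k)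

-- number of pairs i<j with v_i < v_j (inversions relative to δ)
inversions : List ℤ → ℕ
inversions []       = 0
inversions (x ∷ xs) = length (filter (x ℤ.<?_) xs) + inversions xs

χ : (μ ν : List ℕ) → ℤ
χ μ ν = sumℤ (map term (assignments (length ν) k))
  where
  k = ℓ μ
  term : List ℕ → ℤ
  term f = let v = residual (expVec k μ) ν f in
           if isPermOfδ k v then negOnePow (inversions v) else + 0

{-# OPTIONS --safe #-}
module Submission where

-- Σ_{t ∈ Ev λ} (-1)^{ℓ(t)} p_t = Π_i (p_{λ_i}² − p_{2λ_i}), and p_a² − p_{2a} = Σ_{i ≠ j} x_i^a x_j^a
-- raises each variable to the power a at most.  By the Frobenius formula in k = ℓ(μ) variables the
-- sum of the theorem is the coefficient of x^{μ+δ} in a_δ · Π_i (p_{λ_i}² − p_{2λ_i}), where x₁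
-- occurs with exponent at most (k − 1) + n < μ₁ + (k − 1); so the coefficient is 0.  Formally one
-- peels off the parts of λ one at a time, tracking the exponent vector still to be matched: the
-- diagonal terms of p_x² cancel p_{2x}, and every off-diagonal term lowers the first exponent by
-- at most x.

open import Defs
open import Data.Nat using (ℕ; zero; suc; _+_; _*_; _≤_; _<_; _≤ᵇ_)
import Data.Nat.Properties as ℕ
open import Data.List using (List; []; _∷_; map; length; upTo; concatMap; _++_; lookup)
open import Data.List.Membership.Propositional using (_∈_)
open import Data.List.Membership.Propositional.Properties using (∈-upTo⁺)
import Data.List.Relation.Unary.All as All
import Data.List.Relation.Unary.All.Properties as All
open import Data.List.Relation.Unary.Any as Any using (here; there)
import Data.List.Relation.Unary.Any.Properties as Any
open import Data.List.Relation.Unary.Unique.Propositional using (Unique; _∷_)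
import Data.List.Relation.Unary.Unique.Propositional.Properties as Unique
open import Data.Bool using (true; false; T; if_then_else_)
open import Data.Integer as ℤ using (ℤ; +_)
  renaming (_+_ to _+ℤ_; _-_ to _-ℤ_; _*_ to _*ℤ_; _≤_ to _≤ℤ_)
import Data.Integer.Properties as ℤ
open import Data.Integer.Tactic.RingSolver using (solve-∀)
open import Data.Fin as Fin using (Fin; toℕ)
import Data.Fin.Properties as Fin
open import Data.Product using (_,_)
open import Data.Empty using (⊥-elim)
open import Function using (_∘_; Injective)
open import Relation.Nullary using (¬_)
open import Relation.Nullary.Decidable using (toWitness)
open import Relation.Binary.PropositionalEquality using (_≡_; _≢_; refl; sym; trans; cong; cong₂; subst)
open Relation.Binary.PropositionalEquality.≡-Reasoning

∑ : {A : Set} → List A → (A → ℤ) → ℤ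
∑ xs f = sumℤ (map f xs)

infix 5 ∑
syntax ∑ xs (λ x → f) = ∑[ x ← xs ] f

module _ {A : Set} where

  ∑-cong : (xs : List A) {f g : A → ℤ} → (∀ x → f x ≡ g x) → ∑ xs f ≡ ∑ xs g
  ∑-cong []       eq = refl
  ∑-cong (x ∷ xs) eq = cong₂ _+ℤ_ (eq x) (∑-cong xs eq)

  ∑-cong-∈ : (xs : List A) {f g : A → ℤ} → (∀ {x} → x ∈ xs → f x ≡ g x) → ∑ xs f ≡ ∑ xs g
  ∑-cong-∈ []       eq = refl
  ∑-cong-∈ (x ∷ xs) eq = cong₂ _+ℤ_ (eq (here refl)) (∑-cong-∈ xs (eq ∘ there))

  ∑-zero : (xs : List A) → ∑[ x ← xs ] + 0 ≡ + 0
  ∑-zero []       = refl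
  ∑-zero (x ∷ xs) = trans (ℤ.+-identityˡ _) (∑-zero xs)

  ∑-++ : (xs ys : List A) (f : A → ℤ) → ∑ (xs ++ ys) f ≡ ∑ xs f +ℤ ∑ ys f
  ∑-++ []       ys f = sym (ℤ.+-identityˡ (∑ ys f))
  ∑-++ (x ∷ xs) ys f = trans (cong (f x +ℤ_) (∑-++ xs ys f)) (sym (ℤ.+-assoc (f x) _ _))

  ∑-distrib-+ : (xs : List A) (f g : A → ℤ) → ∑[ x ← xs ] (f x +ℤ g x) ≡ ∑ xs f +ℤ ∑ xs g
  ∑-distrib-+ []       f g = refl
  ∑-distrib-+ (x ∷ xs) f g = trans (cong (f x +ℤ g x +ℤ_) (∑-distrib-+ xs f g)) (shuffle (f x) (g x) _ _)
    where
    shuffle : ∀ a b c d → (a +ℤ b) +ℤ (c +ℤ d) ≡ (a +ℤ c) +ℤ (b +ℤ d)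
    shuffle = solve-∀

  ∑-distrib-− : (xs : List A) (f g : A → ℤ) → ∑[ x ← xs ] (f x -ℤ g x) ≡ ∑ xs f -ℤ ∑ xs g
  ∑-distrib-− []       f g = refl
  ∑-distrib-− (x ∷ xs) f g = trans (cong (f x -ℤ g x +ℤ_) (∑-distrib-− xs f g)) (shuffle (f x) (g x) _ _)
    where
    shuffle : ∀ a b c d → (a -ℤ b) +ℤ (c -ℤ d) ≡ (a +ℤ c) -ℤ (b +ℤ d)
    shuffle = solve-∀

  ∑-*ˡ : (xs : List A) (c : ℤ) (f : A → ℤ) → ∑[ x ← xs ] (c *ℤ f x) ≡ c *ℤ ∑ xs f
  ∑-*ˡ []       c f = sym (ℤ.*-zeroʳ c)
  ∑-*ˡ (x ∷ xs) c f = trans (cong (c *ℤ f x +ℤ_) (∑-*ˡ xs c f)) (sym (ℤ.*-distribˡ-+ c (f x) _))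

  ∑-single : {xs : List A} {a : A} (f : A → ℤ) → Unique xs → a ∈ xs →
             (∀ b → b ≢ a → f b ≡ + 0) → ∑ xs f ≡ f a
  ∑-single {x ∷ xs} f (x∉xs ∷ _) (here refl) off = begin
    f x +ℤ ∑ xs f            ≡⟨ cong (f x +ℤ_) (∑-cong-∈ xs (λ b∈xs → off _ (All.lookup x∉xs b∈xs ∘ sym))) ⟩
    f x +ℤ (∑[ b ← xs ] + 0) ≡⟨ cong (f x +ℤ_) (∑-zero xs) ⟩
    f x +ℤ + 0               ≡⟨ ℤ.+-identityʳ (f x) ⟩
    f x                      ∎
  ∑-single {x ∷ xs} f (x∉xs ∷ u) (there a∈xs) off = begin
    f x +ℤ ∑ xs f   ≡⟨ cong₂ _+ℤ_ (off x (All.lookup x∉xs a∈xs)) (∑-single f u a∈xs off) ⟩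
    + 0 +ℤ f _      ≡⟨ ℤ.+-identityˡ _ ⟩
    f _             ∎

module _ {A B : Set} where

  ∑-concatMap : (xs : List A) (G : A → List B) (f : B → ℤ) →
                ∑ (concatMap G xs) f ≡ ∑[ x ← xs ] ∑ (G x) f
  ∑-concatMap []       G f = refl
  ∑-concatMap (x ∷ xs) G f = trans (∑-++ (G x) _ f) (cong (∑ (G x) f +ℤ_) (∑-concatMap xs G f))

  ∑-map : (xs : List A) (g : A → B) (f : B → ℤ) → ∑ (map g xs) f ≡ ∑ xs (f ∘ g)
  ∑-map []       g f = refl
  ∑-map (x ∷ xs) g f = cong (f (g x) +ℤ_) (∑-map xs g f)

  ∑-comm : (xs : List A) (ys : List B) (f : A → B → ℤ) →
           ∑[ x ← xs ] ∑[ y ← ys ] f x y ≡ ∑[ y ← ys ] ∑[ x ← xs ] f x y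
  ∑-comm []       ys f = sym (∑-zero ys)
  ∑-comm (x ∷ xs) ys f = trans (cong (∑ ys (f x) +ℤ_) (∑-comm xs ys f)) (sym (∑-distrib-+ ys (f x) _))

  ∑-*-∑-comm : (xs : List A) (ys : List B) (c : A → ℤ) (f : A → B → ℤ) →
               ∑[ x ← xs ] (c x *ℤ (∑[ y ← ys ] f x y)) ≡ ∑[ y ← ys ] ∑[ x ← xs ] c x *ℤ f x y
  ∑-*-∑-comm xs ys c f = trans (∑-cong xs (λ x → sym (∑-*ˡ ys (c x) (f x)))) (∑-comm xs ys _)

∑-diagonal : {A : Set} {xs : List A} (g : A → A → ℤ) → Unique xs → (∀ a b → a ≢ b → g a b ≡ + 0) →
             ∑[ a ← xs ] ∑[ b ← xs ] g a b ≡ ∑[ a ← xs ] g a a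
∑-diagonal {xs = xs} g u off = ∑-cong-∈ xs (λ a∈xs → ∑-single (g _) u a∈xs (λ b b≢a → off _ b (b≢a ∘ sym)))

∈-pigeonhole : {A : Set} (xs : List A) (f : Fin (suc (length xs)) → A) →
               Injective _≡_ _≡_ f → ¬ (∀ j → f j ∈ xs)
∈-pigeonhole xs f f-inj f∈xs with Fin.pigeonhole (ℕ.n<1+n (length xs)) (Any.index ∘ f∈xs)
... | i , j , i<j , same-index = Fin.<-irrefl (f-inj (begin
  f i                               ≡⟨ Any.lookup-index (f∈xs i) ⟩
  lookup xs (Any.index (f∈xs i))    ≡⟨ cong (lookup xs) same-index ⟩
  lookup xs (Any.index (f∈xs j))    ≡⟨ Any.lookup-index (f∈xs j) ⟨
  f j                               ∎)) i<j

alternantCoeff : ℕ → List ℤ → ℤ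
alternantCoeff k v = if isPermOfδ k v then negOnePow (inversions v) else + 0

isPermOfδ⇒∈ : ∀ k v → T (isPermOfδ k v) → ∀ {j} → j < k → + j ∈ v
isPermOfδ⇒∈ k v perm j<k =
  Any.map (sym ∘ toWitness) (Any.any⁻ _ v (All.lookup (All.all⁺ _ (upTo k) perm) (∈-upTo⁺ j<k)))

alternantCoeff-vanishes : ∀ h rest → + length (h ∷ rest) ≤ℤ h →
                          alternantCoeff (length (h ∷ rest)) (h ∷ rest) ≡ + 0
alternantCoeff-vanishes h rest k≤h with isPermOfδ (length (h ∷ rest)) (h ∷ rest) in perm
... | false = refl
... | true  = ⊥-elim (∈-pigeonhole rest (λ j → + toℕ j) (Fin.toℕ-injective ∘ ℤ.+-injective)
                (λ j → ∈-tail (Fin.toℕ<n j) (isPermOfδ⇒∈ _ _ (subst T (sym perm) _) (Fin.toℕ<n j))))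
  where
  ∈-tail : ∀ {j} → j < length (h ∷ rest) → + j ∈ h ∷ rest → + j ∈ rest
  ∈-tail j<k (here j≡h) = ⊥-elim (ℕ.<⇒≱ j<k (ℤ.drop‿+≤+ (subst (+ length (h ∷ rest) ≤ℤ_) (sym j≡h) k≤h)))
  ∈-tail j<k (there j∈rest) = j∈rest

subAt-comm : ∀ i j (c d : ℤ) v → subAt i c (subAt j d v) ≡ subAt j d (subAt i c v)
subAt-comm i       j       c d []      = refl
subAt-comm zero    zero    c d (x ∷ v) = cong (_∷ v) (swap-subtrahends x d c)
  where
  swap-subtrahends : ∀ x d c → (x -ℤ d) -ℤ c ≡ (x -ℤ c) -ℤ d
  swap-subtrahends = solve-∀
subAt-comm zero    (suc j) c d (x ∷ v) = refl
subAt-comm (suc i) zero    c d (x ∷ v) = refl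
subAt-comm (suc i) (suc j) c d (x ∷ v) = cong (x ∷_) (subAt-comm i j c d v)

subAt-twice : ∀ i a v → subAt i (+ a) (subAt i (+ a) v) ≡ subAt i (+ (2 * a)) v
subAt-twice i       a []      = refl
subAt-twice zero    a (x ∷ v) = cong (_∷ v) (begin
  (x -ℤ + a) -ℤ + a      ≡⟨ subtract-sum x (+ a) ⟩
  x -ℤ (+ a +ℤ + a)      ≡⟨ cong (λ d → x -ℤ (+ a +ℤ d)) (cong +_ (ℕ.+-identityʳ a)) ⟨
  x -ℤ (+ a +ℤ + (a + 0)) ≡⟨ cong (x -ℤ_) (ℤ.pos-+ a (a + 0)) ⟨
  x -ℤ + (2 * a)         ∎)
  where
  subtract-sum : ∀ x d → (x -ℤ d) -ℤ d ≡ x -ℤ (d +ℤ d)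
  subtract-sum = solve-∀
subAt-twice (suc i) a (x ∷ v) = cong (x ∷_) (subAt-twice i a v)

length-subAt : ∀ i d v → length (subAt i d v) ≡ length v
length-subAt i       d []      = refl
length-subAt zero    d (x ∷ v) = refl
length-subAt (suc i) d (x ∷ v) = cong suc (length-subAt i d v)

subAt-residual : ∀ i d e ν f → subAt i d (residual e ν f) ≡ residual (subAt i d e) ν f
subAt-residual i d e []      f       = refl
subAt-residual i d e (a ∷ ν) []      = refl
subAt-residual i d e (a ∷ ν) (j ∷ f) =
  trans (subAt-comm i j d (+ a) _) (cong (subAt j (+ a)) (subAt-residual i d e ν f))

-- The coefficient of x^e in a_δ(x₁,…,x_k)·p_ν(x₁,…,x_k); thus χ μ = frobeniusCoeff (ℓ μ) (expVec (ℓ μ) μ).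
frobeniusCoeff : ℕ → List ℤ → List ℕ → ℤ
frobeniusCoeff k e ν = ∑[ f ← assignments (length ν) k ] alternantCoeff k (residual e ν f)

frobeniusCoeff-∷ : ∀ k e a ν →
                   frobeniusCoeff k e (a ∷ ν) ≡ ∑[ i ← upTo k ] frobeniusCoeff k (subAt i (+ a) e) ν
frobeniusCoeff-∷ k e a ν = begin
  frobeniusCoeff k e (a ∷ ν)
    ≡⟨ ∑-concatMap (upTo k) (λ i → map (i ∷_) fs) _ ⟩
  ∑[ i ← upTo k ] ∑[ f ← map (i ∷_) fs ] alternantCoeff k (residual e (a ∷ ν) f)
    ≡⟨ ∑-cong (upTo k) (λ i → ∑-map fs (i ∷_) _) ⟩
  ∑[ i ← upTo k ] ∑[ f ← fs ] alternantCoeff k (subAt i (+ a) (residual e ν f))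
    ≡⟨ ∑-cong (upTo k) (λ i → ∑-cong fs (λ f → cong (alternantCoeff k) (subAt-residual i (+ a) e ν f))) ⟩
  ∑[ i ← upTo k ] frobeniusCoeff k (subAt i (+ a) e) ν
    ∎
  where
  fs = assignments (length ν) k

frobeniusCoeff-∷-cong : ∀ k a {ν ν′} → (∀ e → frobeniusCoeff k e ν ≡ frobeniusCoeff k e ν′) →
                        ∀ e → frobeniusCoeff k e (a ∷ ν) ≡ frobeniusCoeff k e (a ∷ ν′)
frobeniusCoeff-∷-cong k a {ν} {ν′} eq e = begin
  frobeniusCoeff k e (a ∷ ν)                            ≡⟨ frobeniusCoeff-∷ k e a ν ⟩
  ∑[ i ← upTo k ] frobeniusCoeff k (subAt i (+ a) e) ν  ≡⟨ ∑-cong (upTo k) (λ i → eq _) ⟩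
  ∑[ i ← upTo k ] frobeniusCoeff k (subAt i (+ a) e) ν′ ≡⟨ frobeniusCoeff-∷ k e a ν′ ⟨
  frobeniusCoeff k e (a ∷ ν′)                           ∎

frobeniusCoeff-swap : ∀ k e a b ν → frobeniusCoeff k e (a ∷ b ∷ ν) ≡ frobeniusCoeff k e (b ∷ a ∷ ν)
frobeniusCoeff-swap k e a b ν = begin
  frobeniusCoeff k e (a ∷ b ∷ ν)
    ≡⟨ frobeniusCoeff-∷ k e a (b ∷ ν) ⟩
  ∑[ i ← upTo k ] frobeniusCoeff k (subAt i (+ a) e) (b ∷ ν)
    ≡⟨ ∑-cong (upTo k) (λ i → frobeniusCoeff-∷ k _ b ν) ⟩
  ∑[ i ← upTo k ] ∑[ j ← upTo k ] frobeniusCoeff k (subAt j (+ b) (subAt i (+ a) e)) ν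
    ≡⟨ ∑-comm (upTo k) (upTo k) _ ⟩
  ∑[ j ← upTo k ] ∑[ i ← upTo k ] frobeniusCoeff k (subAt j (+ b) (subAt i (+ a) e)) ν
    ≡⟨ ∑-cong (upTo k) (λ j → ∑-cong (upTo k) (λ i → cong (λ v → frobeniusCoeff k v ν) (subAt-comm j i (+ b) (+ a) e))) ⟩
  ∑[ j ← upTo k ] ∑[ i ← upTo k ] frobeniusCoeff k (subAt i (+ a) (subAt j (+ b) e)) ν
    ≡⟨ ∑-cong (upTo k) (λ j → frobeniusCoeff-∷ k _ a ν) ⟨
  ∑[ j ← upTo k ] frobeniusCoeff k (subAt j (+ b) e) (a ∷ ν)
    ≡⟨ frobeniusCoeff-∷ k e b (a ∷ ν) ⟨
  frobeniusCoeff k e (b ∷ a ∷ ν)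
    ∎

frobeniusCoeff-insert : ∀ k y t e → frobeniusCoeff k e (insert y t) ≡ frobeniusCoeff k e (y ∷ t)
frobeniusCoeff-insert k y []       e = refl
frobeniusCoeff-insert k y (z ∷ zs) e with z ≤ᵇ y
... | true  = refl
... | false = trans (frobeniusCoeff-∷-cong k z (frobeniusCoeff-insert k y zs) e) (frobeniusCoeff-swap k e z y zs)

length-insert : ∀ y t → length (insert y t) ≡ suc (length t)
length-insert y []       = refl
length-insert y (z ∷ zs) with z ≤ᵇ y
... | true  = refl
... | false = cong suc (length-insert y zs)

+[m+n]≤i⇒+n≤i : ∀ m n {i} → + (m + n) ≤ℤ i → + n ≤ℤ i
+[m+n]≤i⇒+n≤i m n = ℤ.≤-trans (ℤ.+≤+ (ℕ.m≤n+m n m))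

+[m+n]≤i⇒+n≤i-+m : ∀ m n {i} → + (m + n) ≤ℤ i → + n ≤ℤ i -ℤ + m
+[m+n]≤i⇒+n≤i-+m m n {i} le = subst (_≤ℤ i -ℤ + m) cancel (ℤ.+-monoˡ-≤ (ℤ.- + m) le)
  where
  cancel : + (m + n) -ℤ + m ≡ + n
  cancel = trans (cong (_-ℤ + m) (ℤ.pos-+ m n)) (add-sub-cancel (+ m) (+ n))
    where
    add-sub-cancel : ∀ a b → (a +ℤ b) -ℤ a ≡ b
    add-sub-cancel = solve-∀

signedEvCoeff : ℕ → List ℕ → List ℤ → ℤ
signedEvCoeff k xs e = ∑[ t ← Ev xs ] negOnePow (ℓ t) *ℤ frobeniusCoeff k e t

-- The two members of Ev contributed by a part x realise the factor p_x² − p_{2x}.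
signedEvCoeff-∷ : ∀ k x xs e → signedEvCoeff k (x ∷ xs) e ≡
  (∑[ a ← upTo k ] ∑[ b ← upTo k ] signedEvCoeff k xs (subAt b (+ x) (subAt a (+ x) e)))
  -ℤ (∑[ a ← upTo k ] signedEvCoeff k xs (subAt a (+ (2 * x)) e))
signedEvCoeff-∷ k x xs e = begin
  signedEvCoeff k (x ∷ xs) e
    ≡⟨ ∑-concatMap (Ev xs) (λ t → insert (2 * x) t ∷ insert x (insert x t) ∷ []) _ ⟩
  ∑[ t ← Ev xs ] (signed (insert (2 * x) t) +ℤ (signed (insert x (insert x t)) +ℤ + 0))
    ≡⟨ ∑-cong (Ev xs) (λ t → trans (cong₂ (λ u v → u +ℤ (v +ℤ + 0)) (signed-2x t) (signed-xx t))
                                     (rearrange (sign t) _ _)) ⟩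
  ∑[ t ← Ev xs ] (sign t *ℤ (∑[ a ← ks ] ∑[ b ← ks ] coeff (subAt b (+ x) (subAt a (+ x) e)) t)
                  -ℤ sign t *ℤ (∑[ a ← ks ] coeff (subAt a (+ (2 * x)) e) t))
    ≡⟨ ∑-distrib-− (Ev xs) _ _ ⟩
  (∑[ t ← Ev xs ] sign t *ℤ (∑[ a ← ks ] ∑[ b ← ks ] coeff (subAt b (+ x) (subAt a (+ x) e)) t))
  -ℤ (∑[ t ← Ev xs ] sign t *ℤ (∑[ a ← ks ] coeff (subAt a (+ (2 * x)) e) t))
    ≡⟨ cong₂ _-ℤ_ (trans (∑-*-∑-comm (Ev xs) ks sign _) (∑-cong ks (λ a → ∑-*-∑-comm (Ev xs) ks sign _)))
                  (∑-*-∑-comm (Ev xs) ks sign _) ⟩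
  (∑[ a ← ks ] ∑[ b ← ks ] signedEvCoeff k xs (subAt b (+ x) (subAt a (+ x) e)))
  -ℤ (∑[ a ← ks ] signedEvCoeff k xs (subAt a (+ (2 * x)) e))
    ∎
  where
  ks : List ℕ
  ks = upTo k
  sign : List ℕ → ℤ
  sign t = negOnePow (ℓ t)
  coeff : List ℤ → List ℕ → ℤ
  coeff = frobeniusCoeff k
  signed : List ℕ → ℤ
  signed u = sign u *ℤ coeff e u
  signed-2x : ∀ t → signed (insert (2 * x) t) ≡ ℤ.- sign t *ℤ (∑[ a ← ks ] coeff (subAt a (+ (2 * x)) e) t)
  signed-2x t = cong₂ _*ℤ_ (cong negOnePow (length-insert (2 * x) t))
                           (trans (frobeniusCoeff-insert k (2 * x) t e) (frobeniusCoeff-∷ k e (2 * x) t))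
  signed-xx : ∀ t → signed (insert x (insert x t)) ≡
              ℤ.- (ℤ.- sign t) *ℤ (∑[ a ← ks ] ∑[ b ← ks ] coeff (subAt b (+ x) (subAt a (+ x) e)) t)
  signed-xx t = cong₂ _*ℤ_
    (cong negOnePow (trans (length-insert x (insert x t)) (cong suc (length-insert x t))))
    (begin
      coeff e (insert x (insert x t))  ≡⟨ frobeniusCoeff-insert k x (insert x t) e ⟩
      coeff e (x ∷ insert x t)         ≡⟨ frobeniusCoeff-∷-cong k x (frobeniusCoeff-insert k x t) e ⟩
      coeff e (x ∷ x ∷ t)              ≡⟨ frobeniusCoeff-∷ k e x (x ∷ t) ⟩
      ∑[ a ← ks ] coeff (subAt a (+ x) e) (x ∷ t)
                                        ≡⟨ ∑-cong ks (λ a → frobeniusCoeff-∷ k _ x t) ⟩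
      ∑[ a ← ks ] ∑[ b ← ks ] coeff (subAt b (+ x) (subAt a (+ x) e)) t ∎)
  rearrange : ∀ s p q → ℤ.- s *ℤ p +ℤ (ℤ.- (ℤ.- s) *ℤ q +ℤ + 0) ≡ s *ℤ q -ℤ s *ℤ p
  rearrange = solve-∀

signedEvCoeff-vanishes : ∀ {k} xs h rest → length (h ∷ rest) ≡ k → + (sumℕ xs + k) ≤ℤ h →
                         signedEvCoeff k xs (h ∷ rest) ≡ + 0
signedEvCoeff-vanishes [] h rest refl k≤h =
  cong (λ c → + 1 *ℤ (c +ℤ + 0) +ℤ + 0) (alternantCoeff-vanishes h rest k≤h)
signedEvCoeff-vanishes {k} (x ∷ xs) h rest len bound = begin
  signedEvCoeff k (x ∷ xs) e
    ≡⟨ signedEvCoeff-∷ k x xs e ⟩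
  (∑[ a ← upTo k ] ∑[ b ← upTo k ] S (subAt b (+ x) (subAt a (+ x) e))) -ℤ X
    ≡⟨ cong (_-ℤ X) (∑-diagonal _ (Unique.upTo⁺ k) off-diagonal) ⟩
  (∑[ a ← upTo k ] S (subAt a (+ x) (subAt a (+ x) e))) -ℤ X
    ≡⟨ cong (_-ℤ X) (∑-cong (upTo k) (λ a → cong S (subAt-twice a x e))) ⟩
  X -ℤ X
    ≡⟨ ℤ.+-inverseʳ X ⟩
  + 0 ∎
  where
  e = h ∷ rest
  S : List ℤ → ℤ
  S = signedEvCoeff k xs
  X : ℤ
  X = ∑[ a ← upTo k ] S (subAt a (+ (2 * x)) e)
  bound′ : + (x + (sumℕ xs + k)) ≤ℤ h
  bound′ = subst (_≤ℤ h) (cong +_ (ℕ.+-assoc x (sumℕ xs) k)) bound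
  len′ : ∀ i d → length (h ∷ subAt i d rest) ≡ k
  len′ i d = trans (cong suc (length-subAt i d rest)) len
  -- As a ≢ b, at most one of the two subtractions of x hits the first exponent.
  off-diagonal : ∀ a b → a ≢ b → S (subAt b (+ x) (subAt a (+ x) e)) ≡ + 0
  off-diagonal zero    zero    a≢b = ⊥-elim (a≢b refl)
  off-diagonal zero    (suc b) _   =
    signedEvCoeff-vanishes xs _ _ (len′ b (+ x)) (+[m+n]≤i⇒+n≤i-+m x _ bound′)
  off-diagonal (suc a) zero    _   =
    signedEvCoeff-vanishes xs _ _ (len′ a (+ x)) (+[m+n]≤i⇒+n≤i-+m x _ bound′)
  off-diagonal (suc a) (suc b) _   =
    signedEvCoeff-vanishes xs _ _ (trans (cong suc (length-subAt b (+ x) (subAt a (+ x) rest))) (len′ a (+ x)))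
                           (+[m+n]≤i⇒+n≤i x _ bound′)

length-expVec : ∀ k μ → length (expVec k μ) ≡ k
length-expVec zero    μ       = refl
length-expVec (suc k) []      = cong suc (length-expVec k [])
length-expVec (suc k) (m ∷ μ) = cong suc (length-expVec k μ)

corollary3p1 : (n : ℕ) (λ' : List ℕ) → IsPartitionOf n λ' →
               (N : ℕ) → 1 ≤ N →
               (μ : List ℕ) → InR N (2 * n) μ → n < firstPart μ →
               sumℤ (map (λ t → negOnePow (ℓ t) *ℤ χ μ t) (Ev λ')) ≡ + 0
corollary3p1 n λ' λ'⊢n N _ (m ∷ μs) _ n<m =
  signedEvCoeff-vanishes λ' (+ (m + k)) (expVec k μs) (cong suc (length-expVec k μs)) (ℤ.+≤+ first-exponent)
  where
  k = length μs
  first-exponent : sumℕ λ' + suc k ≤ m + k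
  first-exponent rewrite IsPartitionOf.total λ'⊢n | ℕ.+-suc n k = ℕ.+-monoˡ-≤ k n<m
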